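{- Let $C$ be a cycle of even length in a graph, and let $P_1,P_2$ be bridges of $C$ that are paths and are crossed on $C$, with $P_1$ of even length. Let $R$ be an adjustable $(y,x)$-path with $y\in V(P_2)\setminus V(C)$, $x\in V(C)$, and all vertices of $R$ other than $x,y$ lying outside $V(P_2)\cup V(C)$, such that $P_1$ and $R$ are internally-disjoint. Then $C\cup P_1\cup P_2\cup R$ contains a cycle whose length is divisible by $4$.
   Context: Graphs are finite and simple; lengths count edges. A path $P$ from $x$ to $y$ is a bridge of the cycle $C$ if $P$ is nontrivial, $P$ and $C$ are edge-disjoint and $V(P)\cap V(C)=\{x,y\}$. Two bridges with end-vertex sets $\{x_1,y_1\}$ and $\{x_2,y_2\}$ are crossed on $C$ if they are vertex-disjoint and $x_1,x_2,y_1,y_2$ appear in this order along $C$. An adjustable $(a,b)$-path is a graph consisting of an odd cycle $D$, a path $Q_1$ from $a$ to a vertex of $D$ having no other vertex on $D$, and a path $Q_2$ from a vertex of $D$ to $b$ having no other vertex on $D$, with $V(Q_1)\cap V(Q_2)=\emptyset$ ($Q_1$, $Q_2$ may be trivial). Internally-disjoint means sharing no vertices other than end-vertices. -}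

module Defs where

open import Data.Nat using (ℕ; suc; _<_; _≤_)
open import Data.Nat.Divisibility using (_∣_)
open import Data.Fin using (Fin)
open import Data.List using (List; []; _∷_; length; lookup)
open import Data.List.Membership.Propositional using (_∈_)
open import Data.List.Relation.Unary.Linked using (Linked)
open import Data.List.Relation.Unary.Unique.Propositional using (Unique)
open import Data.Product using (Σ; ∃; _×_; _,_)
open import Data.Sum using (_⊎_)
open import Relation.Binary.PropositionalEquality using (_≡_)
open import Relation.Nullary using (¬_)
open import Level using (0ℓ)

record Graph (n : ℕ) : Set₁ where
  field
    Adj     : Fin n → Fin n → Set
    sym     : ∀ {u v} → Adj u v → Adj v u
    irrefl  : ∀ {u} → ¬ Adj u u
open Graph public

lastOf : ∀ {A : Set} → A → List A → A
lastOf a []       = a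
lastOf a (b ∷ bs) = lastOf b bs

data Consec {A : Set} : List A → A → A → Set where
  here  : ∀ {u v xs} → Consec (u ∷ v ∷ xs) u v
  there : ∀ {w u v xs} → Consec xs u v → Consec (w ∷ xs) u v

-- Paths: the vertex sequence start ∷ rest (distinct, consecutive adjacent).
-- Its length (number of edges) is length rest.

record Path (n : ℕ) : Set where
  constructor mkPath
  field
    start : Fin n
    rest  : List (Fin n)
open Path public

pverts : ∀ {n} → Path n → List (Fin n)
pverts p = start p ∷ rest p

pend : ∀ {n} → Path n → Fin n
pend p = lastOf (start p) (rest p)

plength : ∀ {n} → Path n → ℕ
plength p = length (rest p)

IsPath : ∀ {n} → Graph n → Path n → Set
IsPath G p = Linked (Adj G) (pverts p) × Unique (pverts p)

PEdge : ∀ {n} → Path n → Fin n → Fin n → Set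
PEdge p u v = Consec (pverts p) u v ⊎ Consec (pverts p) v u

-- Its length (number of edges = number of vertices) is length (c₀ ∷ rest).

record Cycle (n : ℕ) : Set where
  constructor mkCycle
  field
    cstart : Fin n
    crest  : List (Fin n)
open Cycle public

cverts : ∀ {n} → Cycle n → List (Fin n)
cverts c = cstart c ∷ crest c

clength : ∀ {n} → Cycle n → ℕ
clength c = length (cverts c)

IsCycle : ∀ {n} → Graph n → Cycle n → Set
IsCycle G c = (3 ≤ clength c) × Linked (Adj G) (cverts c) × Unique (cverts c)
            × Adj G (lastOf (cstart c) (crest c)) (cstart c)

CDirEdge : ∀ {n} → Cycle n → Fin n → Fin n → Set
CDirEdge c u v = Consec (cverts c) u v ⊎ ((u ≡ lastOf (cstart c) (crest c)) × (v ≡ cstart c))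

CEdge : ∀ {n} → Cycle n → Fin n → Fin n → Set
CEdge c u v = CDirEdge c u v ⊎ CDirEdge c v u

IsBridge : ∀ {n} → Graph n → Cycle n → Path n → Set
IsBridge G C P =
  IsPath G P × (1 ≤ plength P)
  × (∀ u v → PEdge P u v → ¬ CEdge C u v)
  × (start P ∈ cverts C) × (pend P ∈ cverts C)
  × (∀ v → v ∈ pverts P → v ∈ cverts C → (v ≡ start P ⊎ v ≡ pend P))

-- a, b, c, d appear in this order along C (cyclically, starting anywhere)
InCyclicOrder : ∀ {n} → Cycle n → Fin n → Fin n → Fin n → Fin n → Set
InCyclicOrder C a b c d =
  let L = cverts C in
  Σ (Fin (length L)) λ i → Σ (Fin (length L)) λ j →
  Σ (Fin (length L)) λ k → Σ (Fin (length L)) λ l →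
  (Data.Fin._<_ i j) × (Data.Fin._<_ j k) × (Data.Fin._<_ k l) ×
  (  (lookup L i ≡ a × lookup L j ≡ b × lookup L k ≡ c × lookup L l ≡ d)
   ⊎ (lookup L i ≡ b × lookup L j ≡ c × lookup L k ≡ d × lookup L l ≡ a)
   ⊎ (lookup L i ≡ c × lookup L j ≡ d × lookup L k ≡ a × lookup L l ≡ b)
   ⊎ (lookup L i ≡ d × lookup L j ≡ a × lookup L k ≡ b × lookup L l ≡ c))

VertexDisjoint : ∀ {n} → List (Fin n) → List (Fin n) → Set
VertexDisjoint xs ys = ∀ v → v ∈ xs → ¬ (v ∈ ys)

-- bridges with end sets {x₁,y₁}, {x₂,y₂} are crossed on C: vertex-disjoint and,
-- for some labelling of the end-vertex sets, x₁,x₂,y₁,y₂ appear in this order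
Crossed : ∀ {n} → Cycle n → Path n → Path n → Set
Crossed C P₁ P₂ =
  VertexDisjoint (pverts P₁) (pverts P₂) ×
  (  InCyclicOrder C (start P₁) (start P₂) (pend P₁) (pend P₂)
   ⊎ InCyclicOrder C (start P₁) (pend P₂) (pend P₁) (start P₂))

-- Adjustable (a,b)-paths: odd cycle D, path Q₁ from a to D, path Q₂ from D to b

record Adjustable (n : ℕ) : Set where
  constructor mkAdj
  field
    D  : Cycle n
    Q₁ : Path n
    Q₂ : Path n
open Adjustable public

IsAdjustable : ∀ {n} → Graph n → Fin n → Fin n → Adjustable n → Set
IsAdjustable G a b R =
  IsCycle G (D R) × ¬ (2 ∣ clength (D R))
  × IsPath G (Q₁ R) × start (Q₁ R) ≡ a × pend (Q₁ R) ∈ cverts (D R)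
  × (∀ v → v ∈ pverts (Q₁ R) → v ∈ cverts (D R) → v ≡ pend (Q₁ R))
  × IsPath G (Q₂ R) × pend (Q₂ R) ≡ b × start (Q₂ R) ∈ cverts (D R)
  × (∀ v → v ∈ pverts (Q₂ R) → v ∈ cverts (D R) → v ≡ start (Q₂ R))
  × VertexDisjoint (pverts (Q₁ R)) (pverts (Q₂ R))

AVert : ∀ {n} → Adjustable n → Fin n → Set
AVert R v = v ∈ cverts (D R) ⊎ v ∈ pverts (Q₁ R) ⊎ v ∈ pverts (Q₂ R)

AEdge : ∀ {n} → Adjustable n → Fin n → Fin n → Set
AEdge R u v = CEdge (D R) u v ⊎ PEdge (Q₁ R) u v ⊎ PEdge (Q₂ R) u v

-- If |C| ≡ 0 (mod 4) then C itself will do, so let |C| ≡ 2. Let P₁ run from s to t and P₂ from c to d;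
-- as the bridges cross, c and d lie on different s–t arcs of C, and up to swapping s with t and c with d,
-- x is either s or a vertex of the s–t arc through c other than s and t. Going either way round the odd
-- cycle of R gives two y–x paths r₁, r₂ whose lengths differ in parity, and they meet C, P₁ and P₂ only
-- in x and y.
--
-- In the second case C, P₁ and the spoke from d along P₂ to y and then along rᵢ to x form a subdivided K₄
-- whose rim is C. Take i with the spoke of even length. The two cycles using P₁, the two using the spoke,
-- and the two using both have lengths summing to |C| + 2|P₁|, |C| + 2|spoke| and |C| + 2|P₁| + 2|spoke|,
-- all ≡ 2 (mod 4); these three pairs are not all odd, and a pair of even lengths summing to 2 (mod 4)
-- contains one divisible by 4. In the first case C, P₁, P₂ and r₁, r₂ form a subdivided K₄ on s, c, t, d
-- with y on the branch from c to d joined to s by two alternative spokes.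

{-# OPTIONS --safe #-}
module Submission where

open import Data.Bool using (Bool; true; false; _∧_; not; T)
open import Data.Bool.ListAction using (any)
open import Data.Bool.Properties using (T-∧; T-≡)
open import Data.Empty using (⊥; ⊥-elim)
open import Data.Fin using (Fin; zero; suc; _<_; _≟_; #_)
open import Data.List using (List; []; _∷_; _++_; [_]; _∷ʳ_; reverse; length; lookup; map)
open import Data.List.Properties using (++-assoc; ++-identityʳ; length-++; length-reverse; unfold-reverse)
open import Data.List.Membership.Propositional using (_∈_; _∉_)
open import Data.List.Membership.Propositional.Properties using (∈-++⁺ˡ; ∈-++⁺ʳ; ∈-++⁻; ∈-∃++; ∈-insert)
open import Data.List.Relation.Binary.Disjoint.Propositional using (Disjoint)
open import Data.List.Relation.Binary.Permutation.Propositional using (_↭_; ↭-sym; ↭-trans; ↭-reflexive; ↭⇒↭ₛ)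
open import Data.List.Relation.Binary.Permutation.Propositional.Properties
  using (↭-reverse; ↭-length; ∈-resp-↭; ++-comm)
import Data.List.Relation.Binary.Permutation.Setoid.Properties as PermutationSetoid
open import Data.List.Relation.Binary.Subset.Propositional using (_⊆_)
import Data.List.Relation.Unary.All as All
import Data.List.Relation.Unary.All.Properties as All
open import Data.List.Relation.Unary.AllPairs using ([]; _∷_)
open import Data.List.Relation.Unary.Any using (Any; here; there; satisfied)
import Data.List.Relation.Unary.Any.Properties as Any
open import Data.List.Relation.Unary.Any.Properties using (any⁻; reverse⁺; reverse⁻)
open import Data.List.Relation.Unary.Linked using (Linked; []; [-]; _∷_)
import Data.List.Relation.Unary.Linked as Linked
open import Data.List.Relation.Unary.Unique.Propositional using (Unique)
import Data.List.Relation.Unary.Unique.Propositional.Properties as Unique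
open import Data.Nat using (ℕ; zero; suc; _+_; _*_; _≤_; s≤s)
open import Data.Nat.Divisibility using (_∣_; divides; ∣m∣n⇒∣m+n; ∣m+n∣m⇒∣n; ∣-refl; ∣⇒≤)
open import Data.Nat.Properties using (<⇒≤)
open import Data.Nat.Solver using (module +-*-Solver)
open import Data.Product using (Σ; ∃; ∃₂; _×_; _,_; proj₁; proj₂)
import Data.Product as Product
open import Data.Sum using (_⊎_; inj₁; inj₂; [_,_]′)
import Data.Sum as Sum
open import Data.Vec using (Vec; []; _∷_)
import Data.Vec as Vec
open import Data.Vec.Properties using (lookup-map)
open import Function using (_∘_; Equivalence)
open import Relation.Binary.Definitions using (Symmetric)
open import Relation.Binary.PropositionalEquality using (_≡_; _≢_; refl; sym; trans; cong; cong₂; subst; setoid)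
open import Relation.Nullary using (¬_)
open import Relation.Nullary.Decidable using (True; toWitness)

open import Defs hiding (sym)

module _ {A : Set} where

  lastOf-++ : ∀ (u : A) xs ys → lastOf u (xs ++ ys) ≡ lastOf (lastOf u xs) ys
  lastOf-++ u []       ys = refl
  lastOf-++ u (x ∷ xs) ys = lastOf-++ x xs ys

  lastOf-∈ : ∀ (u : A) xs → lastOf u xs ∈ u ∷ xs
  lastOf-∈ u []       = here refl
  lastOf-∈ u (x ∷ xs) = there (lastOf-∈ x xs)

  ∷ʳ-lastOf : ∀ (u : A) xs → xs ≢ [] → ∃ λ m → xs ≡ m ∷ʳ lastOf u xs
  ∷ʳ-lastOf u []           xs≢[] = ⊥-elim (xs≢[] refl)
  ∷ʳ-lastOf u (x ∷ [])     _     = [] , refl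
  ∷ʳ-lastOf u (x ∷ y ∷ xs) _     = Product.map (x ∷_) (cong (x ∷_)) (∷ʳ-lastOf y (y ∷ xs) λ ())

  consec-++ : ∀ {xs a b} ys → Consec {A} xs a b → Consec (xs ++ ys) a b
  consec-++ ys here      = here
  consec-++ ys (there c) = there (consec-++ ys c)

  consec-lastOf : ∀ (u : A) m v → Consec (u ∷ m ++ [ v ]) (lastOf u m) v
  consec-lastOf u []      v = here
  consec-lastOf u (x ∷ m) v = there (consec-lastOf x m v)

  ++-≢[] : ∀ xs {ys : List A} → ys ≢ [] → xs ++ ys ≢ []
  ++-≢[] []      ys≢[] = ys≢[]
  ++-≢[] (_ ∷ _) _     ()

  1≤length⇒≢[] : ∀ {xs : List A} → 1 ≤ length xs → xs ≢ []
  1≤length⇒≢[] {[]}    ()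
  1≤length⇒≢[] {_ ∷ _} _ ()

  length-∷ʳ : ∀ (m : List A) v → length (m ∷ʳ v) ≡ suc (length m)
  length-∷ʳ []      v = refl
  length-∷ʳ (_ ∷ m) v = cong suc (length-∷ʳ m v)

  unique-resp-↭ : ∀ {xs ys : List A} → xs ↭ ys → Unique xs → Unique ys
  unique-resp-↭ p = PermutationSetoid.Unique-resp-↭ (setoid A) (↭⇒↭ₛ p)

  unique-reverse : ∀ {xs : List A} → Unique xs → Unique (reverse xs)
  unique-reverse {xs} = unique-resp-↭ (↭-sym (↭-reverse xs))

  unique-reverse⁻ : ∀ {xs : List A} → Unique (reverse xs) → Unique xs
  unique-reverse⁻ {xs} = unique-resp-↭ (↭-reverse xs)

  unique-++⁻ : ∀ xs {ys : List A} → Unique (xs ++ ys) → Unique xs × Unique ys × Disjoint xs ys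
  unique-++⁻ []       u          = [] , u , λ ()
  unique-++⁻ (x ∷ xs) (x∉ ∷ u) with unique-++⁻ xs u
  ... | u-xs , u-ys , disjoint = All.++⁻ˡ xs x∉ ∷ u-xs , u-ys , λ where
    (here refl , v∈ys) → All.lookup (All.++⁻ʳ xs x∉) v∈ys refl
    (there v∈xs , v∈ys) → disjoint (v∈xs , v∈ys)

  unique-arc : ∀ {s t : A} m {m′} → Unique (s ∷ m ++ t ∷ m′) → Unique m × s ∉ m × t ∉ m
  unique-arc m (s∉ ∷ u) with unique-++⁻ m u
  ... | u-m , _ , disjoint =
    u-m , (λ s∈m → All.lookup (All.++⁻ˡ m s∉) s∈m refl) , λ t∈m → disjoint (t∈m , here refl)

module _ {A : Set} {R : A → A → Set} where

  linked-++⁻ˡ : ∀ xs {ys} → Linked R (xs ++ ys) → Linked R xs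
  linked-++⁻ˡ []           _       = []
  linked-++⁻ˡ (x ∷ [])     _       = [-]
  linked-++⁻ˡ (x ∷ y ∷ xs) (r ∷ l) = r ∷ linked-++⁻ˡ (y ∷ xs) l

  consec-edge : ∀ {xs a b} → Linked R xs → Consec xs a b → R a b
  consec-edge (r ∷ _) here      = r
  consec-edge (_ ∷ l) (there c) = consec-edge l c

  linked-with-consec : ∀ xs → Linked R xs → Linked (λ a b → R a b × Consec xs a b) xs
  linked-with-consec []           []      = []
  linked-with-consec (x ∷ [])     [-]     = [-]
  linked-with-consec (x ∷ y ∷ xs) (r ∷ l) =
    (r , here) ∷ Linked.map (Product.map₂ there) (linked-with-consec (y ∷ xs) l)

  linked-glue : ∀ {u} xs {ys} → Linked R (u ∷ xs) → Linked R (lastOf u xs ∷ ys) → Linked R (u ∷ xs ++ ys)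
  linked-glue []       _       l = l
  linked-glue (_ ∷ xs) (r ∷ l) l′ = r ∷ linked-glue xs l l′

module _ {A : Set} where

  lookup-split₁ : ∀ (L : List A) i → ∃₂ λ P Q → L ≡ P ++ lookup L i ∷ Q
  lookup-split₁ (x ∷ L) zero    = [] , L , refl
  lookup-split₁ (x ∷ L) (suc i) = let P , Q , eq = lookup-split₁ L i in x ∷ P , Q , cong (x ∷_) eq

  lookup-split₂ : ∀ (L : List A) {i j} → i < j →
    ∃₂ λ P Q → ∃ λ R → L ≡ P ++ lookup L i ∷ Q ++ lookup L j ∷ R
  lookup-split₂ (x ∷ L) {zero}  {suc j} _ = let Q , R , eq = lookup-split₁ L j in [] , Q , R , cong (x ∷_) eq
  lookup-split₂ (x ∷ L) {suc i} {suc j} (s≤s i<j) =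
    let P , Q , R , eq = lookup-split₂ L i<j in x ∷ P , Q , R , cong (x ∷_) eq

  lookup-split₃ : ∀ (L : List A) {i j k} → i < j → j < k →
    ∃₂ λ P Q → ∃₂ λ R S → L ≡ P ++ lookup L i ∷ Q ++ lookup L j ∷ R ++ lookup L k ∷ S
  lookup-split₃ (x ∷ L) {zero}  {suc j} {suc k} _ (s≤s j<k) =
    let Q , R , S , eq = lookup-split₂ L j<k in [] , Q , R , S , cong (x ∷_) eq
  lookup-split₃ (x ∷ L) {suc i} {suc j} {suc k} (s≤s i<j) (s≤s j<k) =
    let P , Q , R , S , eq = lookup-split₃ L i<j j<k in x ∷ P , Q , R , S , cong (x ∷_) eq

  lookup-split₄ : ∀ (L : List A) {i j k l} → i < j → j < k → k < l →
    ∃₂ λ P Q → ∃₂ λ R S → ∃ λ U → L ≡ P ++ lookup L i ∷ Q ++ lookup L j ∷ R ++ lookup L k ∷ S ++ lookup L l ∷ U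
  lookup-split₄ (x ∷ L) {zero}  {suc j} {suc k} {suc l} _ (s≤s j<k) (s≤s k<l) =
    let Q , R , S , U , eq = lookup-split₃ L j<k k<l in [] , Q , R , S , U , cong (x ∷_) eq
  lookup-split₄ (x ∷ L) {suc i} {suc j} {suc k} {suc l} (s≤s i<j) (s≤s j<k) (s≤s k<l) =
    let P , Q , R , S , U , eq = lookup-split₄ L i<j j<k k<l in x ∷ P , Q , R , S , U , cong (x ∷_) eq

module Walks {A : Set} (E : A → A → Set) (E-sym : Symmetric E) where

  Walk : A → List A → A → Set
  Walk u m v = Linked E (u ∷ m ++ [ v ])

  walk-++ : ∀ {u v w} m {m′} → Walk u m v → Walk v m′ w → Walk u (m ++ v ∷ m′) w
  walk-++ []      (e ∷ [-]) q = e ∷ q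
  walk-++ (_ ∷ m) (e ∷ p)   q = e ∷ walk-++ m p q

  walk-split : ∀ {u v w} m {m′} → Walk u (m ++ v ∷ m′) w → Walk u m v × Walk v m′ w
  walk-split []      (e ∷ q) = e ∷ [-] , q
  walk-split (_ ∷ m) (e ∷ p) = Product.map₁ (e ∷_) (walk-split m p)

  walk-reverse : ∀ {u v} m → Walk u m v → Walk v (reverse m) u
  walk-reverse []      (e ∷ [-]) = E-sym e ∷ [-]
  walk-reverse (x ∷ m) (e ∷ p)   = subst (λ m′ → Walk _ m′ _) (sym (unfold-reverse x m))
    (walk-++ (reverse m) (walk-reverse m p) (E-sym e ∷ [-]))

  walk-last : ∀ {u v} m → Walk u m v → E (lastOf u m) v
  walk-last {u} {v} m w = consec-edge w (consec-lastOf u m v)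

  walk-glue : ∀ {u v} m {ys} → Walk u m v → Linked E (v ∷ ys) → Linked E (u ∷ m ++ v ∷ ys)
  walk-glue []      (e ∷ [-]) l = e ∷ l
  walk-glue (_ ∷ m) (e ∷ p)   l = e ∷ walk-glue m p l

  linked-close : ∀ {u v} m → Linked E (u ∷ m) → E (lastOf u m) v → Walk u m v
  linked-close []      [-]     e = e ∷ [-]
  linked-close (_ ∷ m) (r ∷ l) e = r ∷ linked-close m l e

  linked⇒walk : ∀ {u} xs → Linked E (u ∷ xs) → xs ≢ [] →
                ∃ λ m → xs ≡ m ∷ʳ lastOf u xs × Walk u m (lastOf u xs)
  linked⇒walk {u} xs l xs≢[] with ∷ʳ-lastOf u xs xs≢[]
  ... | m , xs≡ = m , xs≡ , subst (λ zs → Linked E (u ∷ zs)) xs≡ l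

module Cyclic {A : Set} (E : A → A → Set) (E-sym : Symmetric E) where

  open Walks E E-sym

  record Split (L : List A) (s t : A) : Set where
    constructor split
    field
      π₁ π₂    : List A
      walk₁    : Walk s π₁ t
      walk₂    : Walk t π₂ s
      rotation : s ∷ π₁ ++ t ∷ π₂ ↭ L

  split-swap : ∀ {L s t} → Split L s t → Split L t s
  split-swap {s = s} {t} (split π₁ π₂ w₁ w₂ r) = split π₂ π₁ w₂ w₁ (↭-trans (++-comm (t ∷ π₂) (s ∷ π₁)) r)

  rotate : ∀ {u m} A₀ {s} B → u ∷ m ≡ A₀ ++ s ∷ B → Walk u m u → Walk s (B ++ A₀) s
  rotate []       B refl w = subst (λ m′ → Walk _ m′ _) (sym (++-identityʳ B)) w
  rotate (a ∷ A₀) B refl w = let w₁ , w₂ = walk-split A₀ w in walk-++ B w₂ w₁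

  split-at : ∀ {u m} A₀ {s} A₁ {t} A₂ → u ∷ m ≡ A₀ ++ s ∷ A₁ ++ t ∷ A₂ → Walk u m u → Split (u ∷ m) s t
  split-at A₀ {s} A₁ {t} A₂ eq w = split A₁ (A₂ ++ A₀) (proj₁ halves) (proj₂ halves) rotation
    where
    halves = walk-split A₁ (subst (λ m′ → Walk s m′ s) (++-assoc A₁ (t ∷ A₂) A₀) (rotate A₀ (A₁ ++ t ∷ A₂) eq w))
    rotation = ↭-trans (↭-reflexive (sym (++-assoc (s ∷ A₁) (t ∷ A₂) A₀)))
                       (↭-trans (++-comm (s ∷ A₁ ++ t ∷ A₂) A₀) (↭-reflexive (sym eq)))

  split-between : ∀ {u m s t} → Walk u m u → s ∈ u ∷ m → t ∈ u ∷ m → s ≢ t → Split (u ∷ m) s t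
  split-between w s∈ t∈ s≢t with ∈-∃++ s∈
  ... | A₀ , B , eq with ∈-++⁻ A₀ (subst (_ ∈_) eq t∈)
  ...   | inj₂ (here t≡s)  = ⊥-elim (s≢t (sym t≡s))
  ...   | inj₂ (there t∈B) with ∈-∃++ t∈B
  ...     | A₁ , A₂ , refl = split-at A₀ A₁ A₂ eq w
  split-between w s∈ t∈ s≢t | A₀ , B , eq | inj₁ t∈A₀ with ∈-∃++ t∈A₀
  ... | A₁ , A₂ , refl = split-swap (split-at A₁ A₂ B (trans eq (++-assoc A₁ (_ ∷ A₂) (_ ∷ B))) w)

  record Theta (L : List A) (s t c d : A) : Set where
    constructor theta
    field
      arcs : Split L s t
      c∈π₁ : c ∈ Split.π₁ arcs
      d∈π₂ : d ∈ Split.π₂ arcs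

  theta-swap : ∀ {L s t c d} → Theta L s t c d → Theta L t s d c
  theta-swap (theta σ c∈ d∈) = theta (split-swap σ) d∈ c∈

  four-points⇒thetas : ∀ {u m} A₀ {w₁} A₁ {w₂} A₂ {w₃} A₃ {w₄} A₄ →
    u ∷ m ≡ A₀ ++ w₁ ∷ A₁ ++ w₂ ∷ A₂ ++ w₃ ∷ A₃ ++ w₄ ∷ A₄ → Walk u m u →
    Theta (u ∷ m) w₁ w₃ w₂ w₄ × Theta (u ∷ m) w₂ w₄ w₃ w₁
  four-points⇒thetas A₀ {w₁} A₁ {w₂} A₂ {w₃} A₃ {w₄} A₄ eq w =
    theta (split-at A₀ (A₁ ++ w₂ ∷ A₂) (A₃ ++ w₄ ∷ A₄) eq₁ w) (∈-insert A₁) (∈-++⁺ˡ (∈-insert A₃)) ,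
    theta (split-at (A₀ ++ w₁ ∷ A₁) (A₂ ++ w₃ ∷ A₃) A₄ eq₂ w) (∈-insert A₂) (∈-++⁺ʳ A₄ (∈-insert A₀))
    where
    eq₁ = trans eq (cong (λ zs → A₀ ++ w₁ ∷ zs) (sym (++-assoc A₁ (w₂ ∷ A₂) (w₃ ∷ A₃ ++ w₄ ∷ A₄))))
    eq₂ = trans eq (trans (cong (λ zs → A₀ ++ w₁ ∷ A₁ ++ w₂ ∷ zs) (sym (++-assoc A₂ (w₃ ∷ A₃) (w₄ ∷ A₄))))
                          (sym (++-assoc A₀ (w₁ ∷ A₁) (w₂ ∷ (A₂ ++ w₃ ∷ A₃) ++ w₄ ∷ A₄))))

data Mod4 : Set where
  0₄ 1₄ 2₄ 3₄ : Mod4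

suc₄ : Mod4 → Mod4
suc₄ 0₄ = 1₄
suc₄ 1₄ = 2₄
suc₄ 2₄ = 3₄
suc₄ 3₄ = 0₄

infixl 6 _+₄_
_+₄_ : Mod4 → Mod4 → Mod4
0₄ +₄ b = b
1₄ +₄ b = suc₄ b
2₄ +₄ b = suc₄ (suc₄ b)
3₄ +₄ b = suc₄ (suc₄ (suc₄ b))

[_]₄ : ℕ → Mod4
[ zero  ]₄ = 0₄
[ suc n ]₄ = suc₄ [ n ]₄

suc₄-+₄ : ∀ a b → suc₄ a +₄ b ≡ suc₄ (a +₄ b)
suc₄-+₄ 0₄ b = refl
suc₄-+₄ 1₄ b = refl
suc₄-+₄ 2₄ b = refl
suc₄-+₄ 3₄ 0₄ = refl
suc₄-+₄ 3₄ 1₄ = refl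
suc₄-+₄ 3₄ 2₄ = refl
suc₄-+₄ 3₄ 3₄ = refl

[+]₄ : ∀ m n → [ m + n ]₄ ≡ [ m ]₄ +₄ [ n ]₄
[+]₄ zero    n = refl
[+]₄ (suc m) n = trans (cong suc₄ ([+]₄ m n)) (sym (suc₄-+₄ [ m ]₄ [ n ]₄))

suc₄⁴ : ∀ a → suc₄ (suc₄ (suc₄ (suc₄ a))) ≡ a
suc₄⁴ 0₄ = refl
suc₄⁴ 1₄ = refl
suc₄⁴ 2₄ = refl
suc₄⁴ 3₄ = refl

isZero : Mod4 → Bool
isZero 0₄ = true
isZero _  = false

isEven : Mod4 → Bool
isEven 0₄ = true
isEven 2₄ = true
isEven _  = false

isZero-sound : ∀ {a} → T (isZero a) → a ≡ 0₄
isZero-sound {0₄} _ = refl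

[]₄≡0⇒4∣ : ∀ n → [ n ]₄ ≡ 0₄ → 4 ∣ n
[]₄≡0⇒4∣ zero                      _ = divides 0 refl
[]₄≡0⇒4∣ (suc (suc (suc (suc n)))) h = ∣m∣n⇒∣m+n (∣-refl {4}) ([]₄≡0⇒4∣ n (trans (sym (suc₄⁴ [ n ]₄)) h))
[]₄≡0⇒4∣ (suc zero)                ()
[]₄≡0⇒4∣ (suc (suc zero))          ()
[]₄≡0⇒4∣ (suc (suc (suc zero)))    ()

2∣⇒isEven : ∀ {n} → 2 ∣ n → T (isEven [ n ]₄)
2∣⇒isEven (divides q refl) = even q
  where
  even : ∀ q → T (isEven [ q * 2 ]₄)
  even zero    = _
  even (suc q) with [ q * 2 ]₄ | even q
  ... | 0₄ | _ = _
  ... | 2₄ | _ = _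

isEven⇒2∣ : ∀ n → T (isEven [ n ]₄) → 2 ∣ n
isEven⇒2∣ zero                      _ = divides 0 refl
isEven⇒2∣ (suc (suc zero))          _ = divides 1 refl
isEven⇒2∣ (suc (suc (suc (suc n)))) h =
  ∣m∣n⇒∣m+n (divides 2 refl) (isEven⇒2∣ n (subst (T ∘ isEven) (suc₄⁴ [ n ]₄) h))

odd⇒isOdd : ∀ {n} → ¬ 2 ∣ n → T (not (isEven [ n ]₄))
odd⇒isOdd {n} 2∤n with isEven [ n ]₄ in eq
... | true  = 2∤n (isEven⇒2∣ n (subst T (sym eq) _))
... | false = _

2∣⇒≡0∨≡2 : ∀ {n} → 2 ∣ n → [ n ]₄ ≡ 0₄ ⊎ [ n ]₄ ≡ 2₄
2∣⇒≡0∨≡2 {n} 2∣n with [ n ]₄ | 2∣⇒isEven 2∣n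
... | 0₄ | _ = inj₁ refl
... | 2₄ | _ = inj₂ refl

-- Two routes sharing their first q₁ and last q₂ edges and otherwise running along the two arcs of a cycle of
-- length p₁ + p₂ + 2: if the cycle is odd, their lengths differ in parity.
parity-of-routes : ∀ q₁ q₂ {l₁ l₂ p₁ p₂} → suc l₁ ≡ q₁ + (p₁ + suc q₂) → suc l₂ ≡ q₁ + (p₂ + suc q₂) →
                   ¬ 2 ∣ suc (p₁ + suc p₂) → ¬ 2 ∣ l₁ + l₂
parity-of-routes q₁ q₂ {l₁} {l₂} {p₁} {p₂} h₁ h₂ odd 2∣l =
  odd (∣m+n∣m⇒∣n (subst (2 ∣_) lengths (∣m∣n⇒∣m+n 2∣l (divides 1 refl))) (divides (q₁ + q₂) refl))
  where
  open +-*-Solver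
  lengths : l₁ + l₂ + 2 ≡ (q₁ + q₂) * 2 + suc (p₁ + suc p₂)
  lengths = trans (solve 2 (λ a b → a :+ b :+ con 2 := con 1 :+ a :+ (con 1 :+ b)) refl l₁ l₂)
            (trans (cong₂ _+_ h₁ h₂)
                   (solve 4 (λ a b c d → a :+ (c :+ (con 1 :+ b)) :+ (a :+ (d :+ (con 1 :+ b))) :=
                                          (a :+ b) :* con 2 :+ (con 1 :+ (c :+ (con 1 :+ d)))) refl q₁ q₂ p₁ p₂))

odd-shift : ∀ k {m n} → ¬ 2 ∣ m + n → ¬ 2 ∣ (k + suc m) + (k + suc n)
odd-shift k {m} {n} odd 2∣ = odd (∣m+n∣m⇒∣n (subst (2 ∣_) shifted 2∣) (divides (suc k) refl))
  where
  open +-*-Solver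
  shifted : (k + suc m) + (k + suc n) ≡ suc k * 2 + (m + n)
  shifted = solve 3 (λ k m n → (k :+ (con 1 :+ m)) :+ (k :+ (con 1 :+ n)) := (con 1 :+ k) :* con 2 :+ (m :+ n))
                    refl k m n

_⇒ᵇ_ : Bool → Bool → Bool
true  ⇒ᵇ b = b
false ⇒ᵇ _ = true

all₄ : (Mod4 → Bool) → Bool
all₄ g = g 0₄ ∧ g 1₄ ∧ g 2₄ ∧ g 3₄

T-∧⁻ : ∀ x {y} → T (x ∧ y) → T x × T y
T-∧⁻ x = Equivalence.to (T-∧ {x})

all₄-sound : ∀ g → T (all₄ g) → ∀ a → T (g a)
all₄-sound g h 0₄ = proj₁ (T-∧⁻ (g 0₄) h)
all₄-sound g h 1₄ = proj₁ (T-∧⁻ (g 1₄) (proj₂ (T-∧⁻ (g 0₄) h)))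
all₄-sound g h 2₄ = proj₁ (T-∧⁻ (g 2₄) (proj₂ (T-∧⁻ (g 1₄) (proj₂ (T-∧⁻ (g 0₄) h)))))
all₄-sound g h 3₄ = proj₂ (T-∧⁻ (g 2₄) (proj₂ (T-∧⁻ (g 1₄) (proj₂ (T-∧⁻ (g 0₄) h)))))

every : ∀ j → (Vec Mod4 j → Bool) → Bool
every zero    f = f []
every (suc j) f = all₄ λ a → every j (f ∘ (a ∷_))

every-sound : ∀ j f → T (every j f) → ∀ v → T (f v)
every-sound zero    f h []      = h
every-sound (suc j) f h (a ∷ v) = every-sound j (f ∘ (a ∷_)) (all₄-sound (λ a → every j (f ∘ (a ∷_))) h a) v

every-guarded : ∀ j (guard goal : Vec Mod4 j → Bool) →
  T (every j λ v → guard v ⇒ᵇ goal v) → ∀ v → T (guard v) → T (goal v)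
every-guarded j guard goal h v g with guard v | every-sound j (λ v → guard v ⇒ᵇ goal v) h v
... | true | r = r

infixr 5 _⊕_
data Expr (k : ℕ) : Set where
  atom : Fin k → Expr k
  _⊕_  : Expr k → Expr k → Expr k
  rev  : Expr k → Expr k

value : ∀ {k} → Vec Mod4 k → Expr k → Mod4
value v (atom i) = Vec.lookup v i
value v (e ⊕ f)  = value v e +₄ value v f
value v (rev e)  = value v e

-- If some assembly `base` is duplicate-free, so is every
-- assembly using only atoms of `base`, each at most once (`unique-rearranged`, whose side conditions are
-- decided by evaluation); this carries all the vertex-disjointness bookkeeping below.
module Segments {A : Set} {k : ℕ} (atoms : Vec (List A) k) where

  open import Data.List.Relation.Binary.Subset.DecPropositional (_≟_ {k}) using (_⊆?_)
  open import Data.List.Relation.Unary.Unique.DecPropositional (_≟_ {k}) using (unique?)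

  ⟦_⟧ : Expr k → List A
  ⟦ atom i ⟧ = Vec.lookup atoms i
  ⟦ e ⊕ f ⟧  = ⟦ e ⟧ ++ ⟦ f ⟧
  ⟦ rev e ⟧  = reverse ⟦ e ⟧

  indices : Expr k → List (Fin k)
  indices (atom i) = [ i ]
  indices (e ⊕ f)  = indices e ++ indices f
  indices (rev e)  = indices e

  ∈-⟦⟧⁻ : ∀ {v} e → v ∈ ⟦ e ⟧ → ∃ λ i → i ∈ indices e × v ∈ Vec.lookup atoms i
  ∈-⟦⟧⁻ (atom i) v∈ = i , here refl , v∈
  ∈-⟦⟧⁻ (e ⊕ f)  v∈ with ∈-++⁻ ⟦ e ⟧ v∈
  ... | inj₁ v∈e = Product.map₂ (Product.map₁ ∈-++⁺ˡ) (∈-⟦⟧⁻ e v∈e)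
  ... | inj₂ v∈f = Product.map₂ (Product.map₁ (∈-++⁺ʳ (indices e))) (∈-⟦⟧⁻ f v∈f)
  ∈-⟦⟧⁻ (rev e)  v∈ = ∈-⟦⟧⁻ e (reverse⁻ v∈)

  ∈-⟦⟧⁺ : ∀ {v i} e → i ∈ indices e → v ∈ Vec.lookup atoms i → v ∈ ⟦ e ⟧
  ∈-⟦⟧⁺ (atom i) (here refl) v∈ = v∈
  ∈-⟦⟧⁺ (e ⊕ f)  i∈ v∈ with ∈-++⁻ (indices e) i∈
  ... | inj₁ i∈e = ∈-++⁺ˡ (∈-⟦⟧⁺ e i∈e v∈)
  ... | inj₂ i∈f = ∈-++⁺ʳ ⟦ e ⟧ (∈-⟦⟧⁺ f i∈f v∈)
  ∈-⟦⟧⁺ (rev e)  i∈ v∈ = reverse⁺ (∈-⟦⟧⁺ e i∈ v∈)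

  shared-atom⇒same : ∀ {v i j} e → Unique ⟦ e ⟧ → i ∈ indices e → j ∈ indices e →
                     v ∈ Vec.lookup atoms i → v ∈ Vec.lookup atoms j → i ≡ j
  shared-atom⇒same (atom _) _ (here refl) (here refl) _ _ = refl
  shared-atom⇒same (e ⊕ f)  u i∈ j∈ v∈i v∈j with unique-++⁻ ⟦ e ⟧ u | ∈-++⁻ (indices e) i∈ | ∈-++⁻ (indices e) j∈
  ... | u-e , _ , _ | inj₁ i∈e | inj₁ j∈e = shared-atom⇒same e u-e i∈e j∈e v∈i v∈j
  ... | _ , u-f , _ | inj₂ i∈f | inj₂ j∈f = shared-atom⇒same f u-f i∈f j∈f v∈i v∈j
  ... | _ , _ , disjoint | inj₁ i∈e | inj₂ j∈f = ⊥-elim (disjoint (∈-⟦⟧⁺ e i∈e v∈i , ∈-⟦⟧⁺ f j∈f v∈j))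
  ... | _ , _ , disjoint | inj₂ i∈f | inj₁ j∈e = ⊥-elim (disjoint (∈-⟦⟧⁺ e j∈e v∈j , ∈-⟦⟧⁺ f i∈f v∈i))
  shared-atom⇒same (rev e)  u i∈ j∈ v∈i v∈j = shared-atom⇒same e (unique-reverse⁻ u) i∈ j∈ v∈i v∈j

  atom-unique : ∀ {i} e → Unique ⟦ e ⟧ → i ∈ indices e → Unique (Vec.lookup atoms i)
  atom-unique (atom _) u (here refl) = u
  atom-unique (e ⊕ f)  u i∈ with unique-++⁻ ⟦ e ⟧ u | ∈-++⁻ (indices e) i∈
  ... | u-e , _ , _ | inj₁ i∈e = atom-unique e u-e i∈e
  ... | _ , u-f , _ | inj₂ i∈f = atom-unique f u-f i∈f
  atom-unique (rev e)  u i∈ = atom-unique e (unique-reverse⁻ u) i∈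

  unique-⟦⟧ : ∀ base e → Unique ⟦ base ⟧ → indices e ⊆ indices base → Unique (indices e) → Unique ⟦ e ⟧
  unique-⟦⟧ base (atom i) u sub _ = atom-unique base u (sub (here refl))
  unique-⟦⟧ base (e ⊕ f)  u sub u-ef with unique-++⁻ (indices e) u-ef
  ... | u-ie , u-if , disjoint = Unique.++⁺ (unique-⟦⟧ base e u (sub ∘ ∈-++⁺ˡ) u-ie)
                                             (unique-⟦⟧ base f u (sub ∘ ∈-++⁺ʳ (indices e)) u-if)
                                             shared
    where
    shared : Disjoint ⟦ e ⟧ ⟦ f ⟧
    shared (v∈e , v∈f) with ∈-⟦⟧⁻ e v∈e | ∈-⟦⟧⁻ f v∈f
    ... | i , i∈e , v∈i | j , j∈f , v∈j = disjoint (i∈e , subst (_∈ indices f) (sym i≡j) j∈f)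
      where i≡j = shared-atom⇒same base u (sub (∈-++⁺ˡ i∈e)) (sub (∈-++⁺ʳ (indices e) j∈f)) v∈i v∈j
  unique-⟦⟧ base (rev e)  u sub u-e = unique-reverse (unique-⟦⟧ base e u sub u-e)

  unique-rearranged : ∀ base → Unique ⟦ base ⟧ → ∀ e →
    {_ : True (indices e ⊆? indices base)} {_ : True (unique? (indices e))} → Unique ⟦ e ⟧
  unique-rearranged base u e {sub} {u-e} = unique-⟦⟧ base e u (toWitness sub) (toWitness u-e)

  lengths : Vec Mod4 k
  lengths = Vec.map ([_]₄ ∘ length) atoms

  length-⟦⟧ : ∀ e → [ length ⟦ e ⟧ ]₄ ≡ value lengths e
  length-⟦⟧ (atom i) = sym (lookup-map i ([_]₄ ∘ length) atoms)
  length-⟦⟧ (e ⊕ f)  = trans (cong [_]₄ (length-++ ⟦ e ⟧))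
                             (trans ([+]₄ (length ⟦ e ⟧) _) (cong₂ _+₄_ (length-⟦⟧ e) (length-⟦⟧ f)))
  length-⟦⟧ (rev e)  = trans (cong [_]₄ (length-reverse ⟦ e ⟧)) (length-⟦⟧ e)

unique-reverse-leg : ∀ {A : Set} (xs ys σ₁ : List A) {y} σ₂ zs →
  Unique (xs ++ ys ++ (σ₁ ++ y ∷ σ₂) ++ zs) → Unique (xs ++ ys ++ reverse σ₂ ++ y ∷ zs)
unique-reverse-leg xs ys σ₁ {y} σ₂ zs u =
  unique-rearranged (atom (# 0) ⊕ atom (# 1) ⊕ (atom (# 2) ⊕ atom (# 3) ⊕ atom (# 4)) ⊕ atom (# 5)) u
                    (atom (# 0) ⊕ atom (# 1) ⊕ rev (atom (# 4)) ⊕ atom (# 3) ⊕ atom (# 5))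
  where open Segments (xs ∷ ys ∷ σ₁ ∷ [ y ] ∷ σ₂ ∷ zs ∷ [])

-- The value of `K₄.rim` and of `Spoke.rim` under the respective `lengths`.
rim-length : Mod4 → Mod4 → Mod4 → Mod4 → Mod4
rim-length e₁ e₂ e₃ e₄ = 1₄ +₄ ((e₁ +₄ (1₄ +₄ e₂)) +₄ (1₄ +₄ (e₃ +₄ (1₄ +₄ e₄))))

rim-chord-guard : Vec Mod4 5 → Bool
rim-chord-guard (e₁ ∷ e₂ ∷ e₃ ∷ e₄ ∷ p ∷ []) = isZero (rim-length e₁ e₂ e₃ e₄ +₄ 2₄) ∧ isEven (suc₄ p)

rim-chord-guard-intro : ∀ e₁ e₂ e₃ e₄ {n} → rim-length e₁ e₂ e₃ e₄ ≡ 2₄ → 2 ∣ suc n →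
  T (rim-chord-guard (e₁ ∷ e₂ ∷ e₃ ∷ e₄ ∷ [ n ]₄ ∷ []))
rim-chord-guard-intro _ _ _ _ {n} rim≡2 2∣ =
  subst (λ r → T (isZero (r +₄ 2₄) ∧ isEven (suc₄ [ n ]₄))) (sym rim≡2) (2∣⇒isEven 2∣)

-- The guards on the first five residues are tested before the remaining ones are enumerated, which keeps
-- the exhaustive checks below small.
check-shapes : ∀ {k} j → (Vec Mod4 5 → Vec Mod4 j → Vec Mod4 k) → (Vec Mod4 j → Bool) → List (Expr k) → Bool
check-shapes j lengths guard shapes =
  every 5 λ u → rim-chord-guard u ⇒ᵇ every j λ w → guard w ⇒ᵇ any (isZero ∘ value (lengths u w)) shapes

check-shapes-sound : ∀ {k} j lengths guard (shapes : List (Expr k)) → check-shapes j lengths guard shapes ≡ true →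
  ∀ u w → T (rim-chord-guard u) → T (guard w) → Any (T ∘ isZero ∘ value (lengths u w)) shapes
check-shapes-sound j lengths guard shapes checked u w u-ok w-ok =
  any⁻ _ shapes (every-guarded j guard (goal u) stage₂-ok w w-ok)
  where
  goal : Vec Mod4 5 → Vec Mod4 j → Bool
  goal u w = any (isZero ∘ value (lengths u w)) shapes
  stage₂ : Vec Mod4 5 → Bool
  stage₂ u = every j λ w → guard w ⇒ᵇ goal u w
  stage₂-ok : T (stage₂ u)
  stage₂-ok = every-guarded 5 rim-chord-guard stage₂ (Equivalence.from T-≡ checked) u u-ok

-- Atoms: the branch vertices a, b, c, d (singletons, hence the 1₄ in `lengths`), the interiors α₁ … α₄ of
-- the rim arcs a → b → c → d → a, the interior ρ of the chord from a to c, and the interiors z₁, z₂ of two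
-- alternative spokes from d to b. A shape lists the atoms of a cycle in order around it.
module K₄ where

  a α₁ b α₂ c α₃ d α₄ ρ z₁ z₂ : Expr 11
  a  = atom (# 0)
  α₁ = atom (# 1)
  b  = atom (# 2)
  α₂ = atom (# 3)
  c  = atom (# 4)
  α₃ = atom (# 5)
  d  = atom (# 6)
  α₄ = atom (# 7)
  ρ  = atom (# 8)
  z₁ = atom (# 9)
  z₂ = atom (# 10)

  rim : Expr 11
  rim = a ⊕ (α₁ ⊕ b ⊕ α₂) ⊕ c ⊕ (α₃ ⊕ d ⊕ α₄)

  abc acd : Expr 11
  abc = a ⊕ α₁ ⊕ b ⊕ α₂ ⊕ c ⊕ rev ρ
  acd = a ⊕ ρ ⊕ c ⊕ α₃ ⊕ d ⊕ α₄

  bad bcd bacd bcad : Expr 11 → Expr 11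
  bad  z = b ⊕ rev α₁ ⊕ a ⊕ rev α₄ ⊕ d ⊕ z
  bcd  z = b ⊕ α₂ ⊕ c ⊕ α₃ ⊕ d ⊕ z
  bacd z = b ⊕ rev α₁ ⊕ a ⊕ ρ ⊕ c ⊕ α₃ ⊕ d ⊕ z
  bcad z = b ⊕ α₂ ⊕ c ⊕ rev ρ ⊕ a ⊕ rev α₄ ⊕ d ⊕ z

  shapes : List (Expr 11)
  shapes = abc ∷ acd ∷ bad z₁ ∷ bcd z₁ ∷ bacd z₁ ∷ bcad z₁ ∷ bad z₂ ∷ bcd z₂ ∷ bacd z₂ ∷ bcad z₂ ∷ []

  lengths : Vec Mod4 5 → Vec Mod4 2 → Vec Mod4 11
  lengths (e₁ ∷ e₂ ∷ e₃ ∷ e₄ ∷ p ∷ []) w = 1₄ ∷ e₁ ∷ 1₄ ∷ e₂ ∷ 1₄ ∷ e₃ ∷ 1₄ ∷ e₄ ∷ p ∷ w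

  odd-spokes : Vec Mod4 2 → Bool
  odd-spokes (f₁ ∷ f₂ ∷ []) = not (isEven (f₁ +₄ f₂))

  checked : check-shapes 2 lengths odd-spokes shapes ≡ true
  checked = refl

-- As in `K₄`, but with legs σ from b to y and τ from y to d, and two alternative spokes r₁, r₂ from y to a.
module Spoke where

  a α₁ b α₂ c α₃ d α₄ ρ σ y τ r₁ r₂ : Expr 14
  a  = atom (# 0)
  α₁ = atom (# 1)
  b  = atom (# 2)
  α₂ = atom (# 3)
  c  = atom (# 4)
  α₃ = atom (# 5)
  d  = atom (# 6)
  α₄ = atom (# 7)
  ρ  = atom (# 8)
  σ  = atom (# 9)
  y  = atom (# 10)
  τ  = atom (# 11)
  r₁ = atom (# 12)
  r₂ = atom (# 13)

  rim : Expr 14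
  rim = a ⊕ (α₁ ⊕ b ⊕ α₂) ⊕ c ⊕ (α₃ ⊕ d ⊕ α₄)

  bcdy bady : Expr 14
  bcdy = b ⊕ α₂ ⊕ c ⊕ α₃ ⊕ d ⊕ rev (σ ⊕ y ⊕ τ)
  bady = b ⊕ rev α₁ ⊕ a ⊕ rev α₄ ⊕ d ⊕ rev (σ ⊕ y ⊕ τ)

  aby adcby ady abcdy acby acdy : Expr 14 → Expr 14
  aby   r = a ⊕ α₁ ⊕ b ⊕ σ ⊕ y ⊕ r
  adcby r = a ⊕ rev α₄ ⊕ d ⊕ rev α₃ ⊕ c ⊕ rev α₂ ⊕ b ⊕ σ ⊕ y ⊕ r
  ady   r = a ⊕ rev α₄ ⊕ d ⊕ rev τ ⊕ y ⊕ r
  abcdy r = a ⊕ α₁ ⊕ b ⊕ α₂ ⊕ c ⊕ α₃ ⊕ d ⊕ rev τ ⊕ y ⊕ r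
  acby  r = a ⊕ ρ ⊕ c ⊕ rev α₂ ⊕ b ⊕ σ ⊕ y ⊕ r
  acdy  r = a ⊕ ρ ⊕ c ⊕ α₃ ⊕ d ⊕ rev τ ⊕ y ⊕ r

  shapes : List (Expr 14)
  shapes = bcdy ∷ bady ∷ aby r₁ ∷ adcby r₁ ∷ ady r₁ ∷ abcdy r₁ ∷ acby r₁ ∷ acdy r₁
                       ∷ aby r₂ ∷ adcby r₂ ∷ ady r₂ ∷ abcdy r₂ ∷ acby r₂ ∷ acdy r₂ ∷ []

  lengths : Vec Mod4 5 → Vec Mod4 4 → Vec Mod4 14
  lengths (e₁ ∷ e₂ ∷ e₃ ∷ e₄ ∷ p ∷ []) (l₁ ∷ l₂ ∷ f₁ ∷ f₂ ∷ []) =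
    1₄ ∷ e₁ ∷ 1₄ ∷ e₂ ∷ 1₄ ∷ e₃ ∷ 1₄ ∷ e₄ ∷ p ∷ l₁ ∷ 1₄ ∷ l₂ ∷ f₁ ∷ f₂ ∷ []

  odd-spokes : Vec Mod4 4 → Bool
  odd-spokes (_ ∷ _ ∷ f₁ ∷ f₂ ∷ []) = not (isEven (f₁ +₄ f₂))

  checked : check-shapes 4 lengths odd-spokes shapes ≡ true
  checked = refl

Cycle0mod4 : ∀ {n} → Graph n → (Fin n → Fin n → Set) → Set
Cycle0mod4 {n} G H = Σ (Cycle n) λ K → IsCycle G K × (∀ u v → CEdge K u v → H u v) × 4 ∣ clength K

module InGraph {n} (G : Graph n) (H : Fin n → Fin n → Set) (H-sym : Symmetric H) where

  E : Fin n → Fin n → Set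
  E u v = Adj G u v × H u v

  E-sym : Symmetric E
  E-sym (a , h) = Graph.sym G a , H-sym h

  open Walks E E-sym public
  open Cyclic E E-sym public

  path⇒linked : ∀ {P} → IsPath G P → (∀ {a b} → PEdge P a b → H a b) → Linked E (pverts P)
  path⇒linked {P} (adj , _) P⊆H = Linked.map (λ (r , c) → r , P⊆H (inj₁ c)) (linked-with-consec (pverts P) adj)

  cycle⇒walk : ∀ {K} → IsCycle G K → (∀ {a b} → CEdge K a b → H a b) → Walk (cstart K) (crest K) (cstart K)
  cycle⇒walk {K} (_ , adj , _ , closing) K⊆H =
    linked-close (crest K) (Linked.map (λ (r , c) → r , K⊆H (inj₁ (inj₁ c))) (linked-with-consec (cverts K) adj))
                 (closing , K⊆H (inj₁ (inj₂ (refl , refl))))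

  ClosedWalk : List (Fin n) → Set
  ClosedWalk []      = ⊥
  ClosedWalk (u ∷ m) = Walk u m u

  closed⇒cycle : ∀ ws → ClosedWalk ws → Unique ws → 4 ∣ length ws → Cycle0mod4 G H
  closed⇒cycle (u ∷ m) w ws-unique 4∣ =
    mkCycle u m , (<⇒≤ (∣⇒≤ 4∣) , Linked.map proj₁ (linked-++⁻ˡ (u ∷ m) w) , ws-unique , proj₁ (walk-last m w)) ,
    edges , 4∣
    where
    directed : ∀ {a b} → CDirEdge (mkCycle u m) a b → E a b
    directed (inj₁ c)            = consec-edge w (consec-++ [ u ] c)
    directed (inj₂ (refl , refl)) = walk-last m w
    edges : ∀ a b → CEdge (mkCycle u m) a b → H a b
    edges a b (inj₁ e) = proj₂ (directed e)
    edges a b (inj₂ e) = H-sym (proj₂ (directed e))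

  module Circuits {k} (atoms : Vec (List (Fin n)) k) where

    open Segments atoms public

    record Circuit : Set where
      constructor circuit
      field
        shape  : Expr k
        closed : ClosedWalk ⟦ shape ⟧
        simple : Unique ⟦ shape ⟧

    circuit⇒cycle : ∀ cs → Any (T ∘ isZero ∘ value lengths) (map Circuit.shape cs) → Cycle0mod4 G H
    circuit⇒cycle cs some with satisfied (Any.map⁻ some)
    ... | circuit e w u , e≡0 = closed⇒cycle ⟦ e ⟧ w u ([]₄≡0⇒4∣ _ (trans (length-⟦⟧ e) (isZero-sound e≡0)))

  record K₄Skeleton : Set where
    field
      a b c d             : Fin n
      α₁ α₂ α₃ α₄ ρ z₁ z₂ : List (Fin n)
      arc₁    : Walk a α₁ b
      arc₂    : Walk b α₂ c
      arc₃    : Walk c α₃ d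
      arc₄    : Walk d α₄ a
      chord   : Walk a ρ c
      spoke₁  : Walk d z₁ b
      spoke₂  : Walk d z₂ b
      unique₁ : Unique ((a ∷ (α₁ ++ b ∷ α₂) ++ c ∷ (α₃ ++ d ∷ α₄)) ++ ρ ++ z₁)
      unique₂ : Unique ((a ∷ (α₁ ++ b ∷ α₂) ++ c ∷ (α₃ ++ d ∷ α₄)) ++ ρ ++ z₂)

  K₄-cycle : (S : K₄Skeleton) → let open K₄Skeleton S in
    [ length (a ∷ (α₁ ++ b ∷ α₂) ++ c ∷ (α₃ ++ d ∷ α₄)) ]₄ ≡ 2₄ → 2 ∣ suc (length ρ) →
    ¬ 2 ∣ length z₁ + length z₂ → Cycle0mod4 G H
  K₄-cycle S rim≡2 ρ-even z-odd = circuit⇒cycle circuits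
    (check-shapes-sound 2 K₄.lengths K₄.odd-spokes K₄.shapes K₄.checked u w
      (rim-chord-guard-intro [ length α₁ ]₄ [ length α₂ ]₄ [ length α₃ ]₄ [ length α₄ ]₄
        (trans (sym (length-⟦⟧ K₄.rim)) rim≡2) ρ-even)
      (subst (T ∘ not ∘ isEven) ([+]₄ (length z₁) (length z₂)) (odd⇒isOdd z-odd)))
    where
    open K₄Skeleton S
    atoms : Vec (List (Fin n)) 11
    atoms = [ a ] ∷ α₁ ∷ [ b ] ∷ α₂ ∷ [ c ] ∷ α₃ ∷ [ d ] ∷ α₄ ∷ ρ ∷ z₁ ∷ z₂ ∷ []
    open Circuits atoms
    u : Vec Mod4 5
    u = [ length α₁ ]₄ ∷ [ length α₂ ]₄ ∷ [ length α₃ ]₄ ∷ [ length α₄ ]₄ ∷ [ length ρ ]₄ ∷ []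
    w : Vec Mod4 2
    w = [ length z₁ ]₄ ∷ [ length z₂ ]₄ ∷ []
    simple₁ = unique-rearranged (K₄.rim ⊕ K₄.ρ ⊕ K₄.z₁) unique₁
    simple₂ = unique-rearranged (K₄.rim ⊕ K₄.ρ ⊕ K₄.z₂) unique₂
    arc₁⁻ = walk-reverse α₁ arc₁
    arc₄⁻ = walk-reverse α₄ arc₄
    chord⁻ = walk-reverse ρ chord
    circuits : List Circuit
    circuits =
      circuit K₄.abc (walk-++ α₁ arc₁ (walk-++ α₂ arc₂ chord⁻)) (simple₁ K₄.abc) ∷
      circuit K₄.acd (walk-++ ρ chord (walk-++ α₃ arc₃ arc₄)) (simple₁ K₄.acd) ∷
      circuit (K₄.bad K₄.z₁) (walk-++ (reverse α₁) arc₁⁻ (walk-++ (reverse α₄) arc₄⁻ spoke₁))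
              (simple₁ (K₄.bad K₄.z₁)) ∷
      circuit (K₄.bcd K₄.z₁) (walk-++ α₂ arc₂ (walk-++ α₃ arc₃ spoke₁))
              (simple₁ (K₄.bcd K₄.z₁)) ∷
      circuit (K₄.bacd K₄.z₁) (walk-++ (reverse α₁) arc₁⁻ (walk-++ ρ chord (walk-++ α₃ arc₃ spoke₁)))
              (simple₁ (K₄.bacd K₄.z₁)) ∷
      circuit (K₄.bcad K₄.z₁) (walk-++ α₂ arc₂ (walk-++ (reverse ρ) chord⁻ (walk-++ (reverse α₄) arc₄⁻ spoke₁)))
              (simple₁ (K₄.bcad K₄.z₁)) ∷
      circuit (K₄.bad K₄.z₂) (walk-++ (reverse α₁) arc₁⁻ (walk-++ (reverse α₄) arc₄⁻ spoke₂))
              (simple₂ (K₄.bad K₄.z₂)) ∷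
      circuit (K₄.bcd K₄.z₂) (walk-++ α₂ arc₂ (walk-++ α₃ arc₃ spoke₂))
              (simple₂ (K₄.bcd K₄.z₂)) ∷
      circuit (K₄.bacd K₄.z₂) (walk-++ (reverse α₁) arc₁⁻ (walk-++ ρ chord (walk-++ α₃ arc₃ spoke₂)))
              (simple₂ (K₄.bacd K₄.z₂)) ∷
      circuit (K₄.bcad K₄.z₂) (walk-++ α₂ arc₂ (walk-++ (reverse ρ) chord⁻ (walk-++ (reverse α₄) arc₄⁻ spoke₂)))
              (simple₂ (K₄.bcad K₄.z₂)) ∷ []

  record SpokeSkeleton : Set where
    field
      a b c d y                 : Fin n
      α₁ α₂ α₃ α₄ ρ σ τ r₁ r₂   : List (Fin n)
      arc₁    : Walk a α₁ b
      arc₂    : Walk b α₂ c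
      arc₃    : Walk c α₃ d
      arc₄    : Walk d α₄ a
      chord   : Walk a ρ c
      leg₁    : Walk b σ y
      leg₂    : Walk y τ d
      spoke₁  : Walk y r₁ a
      spoke₂  : Walk y r₂ a
      unique₁ : Unique ((a ∷ (α₁ ++ b ∷ α₂) ++ c ∷ (α₃ ++ d ∷ α₄)) ++ ρ ++ (σ ++ y ∷ τ) ++ r₁)
      unique₂ : Unique ((a ∷ (α₁ ++ b ∷ α₂) ++ c ∷ (α₃ ++ d ∷ α₄)) ++ ρ ++ (σ ++ y ∷ τ) ++ r₂)

  spoke-cycle : (S : SpokeSkeleton) → let open SpokeSkeleton S in
    [ length (a ∷ (α₁ ++ b ∷ α₂) ++ c ∷ (α₃ ++ d ∷ α₄)) ]₄ ≡ 2₄ → 2 ∣ suc (length ρ) →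
    ¬ 2 ∣ length r₁ + length r₂ → Cycle0mod4 G H
  spoke-cycle S rim≡2 ρ-even r-odd = circuit⇒cycle circuits
    (check-shapes-sound 4 Spoke.lengths Spoke.odd-spokes Spoke.shapes Spoke.checked u w
      (rim-chord-guard-intro [ length α₁ ]₄ [ length α₂ ]₄ [ length α₃ ]₄ [ length α₄ ]₄
        (trans (sym (length-⟦⟧ Spoke.rim)) rim≡2) ρ-even)
      (subst (T ∘ not ∘ isEven) ([+]₄ (length r₁) (length r₂)) (odd⇒isOdd r-odd)))
    where
    open SpokeSkeleton S
    atoms : Vec (List (Fin n)) 14
    atoms = [ a ] ∷ α₁ ∷ [ b ] ∷ α₂ ∷ [ c ] ∷ α₃ ∷ [ d ] ∷ α₄ ∷ ρ ∷ σ ∷ [ y ] ∷ τ ∷ r₁ ∷ r₂ ∷ []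
    open Circuits atoms
    u : Vec Mod4 5
    u = [ length α₁ ]₄ ∷ [ length α₂ ]₄ ∷ [ length α₃ ]₄ ∷ [ length α₄ ]₄ ∷ [ length ρ ]₄ ∷ []
    w : Vec Mod4 4
    w = [ length σ ]₄ ∷ [ length τ ]₄ ∷ [ length r₁ ]₄ ∷ [ length r₂ ]₄ ∷ []
    simple₁ = unique-rearranged (Spoke.rim ⊕ Spoke.ρ ⊕ (Spoke.σ ⊕ Spoke.y ⊕ Spoke.τ) ⊕ Spoke.r₁) unique₁
    simple₂ = unique-rearranged (Spoke.rim ⊕ Spoke.ρ ⊕ (Spoke.σ ⊕ Spoke.y ⊕ Spoke.τ) ⊕ Spoke.r₂) unique₂
    arc₁⁻ = walk-reverse α₁ arc₁
    arc₂⁻ = walk-reverse α₂ arc₂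
    arc₃⁻ = walk-reverse α₃ arc₃
    arc₄⁻ = walk-reverse α₄ arc₄
    leg₂⁻ = walk-reverse τ leg₂
    legs⁻ = walk-reverse (σ ++ y ∷ τ) (walk-++ σ leg₁ leg₂)
    circuits : List Circuit
    circuits =
      circuit Spoke.bcdy (walk-++ α₂ arc₂ (walk-++ α₃ arc₃ legs⁻)) (simple₁ Spoke.bcdy) ∷
      circuit Spoke.bady (walk-++ (reverse α₁) arc₁⁻ (walk-++ (reverse α₄) arc₄⁻ legs⁻)) (simple₁ Spoke.bady) ∷
      circuit (Spoke.aby Spoke.r₁) (walk-++ α₁ arc₁ (walk-++ σ leg₁ spoke₁))
              (simple₁ (Spoke.aby Spoke.r₁)) ∷
      circuit (Spoke.adcby Spoke.r₁)
              (walk-++ (reverse α₄) arc₄⁻ (walk-++ (reverse α₃) arc₃⁻ (walk-++ (reverse α₂) arc₂⁻ (walk-++ σ leg₁ spoke₁))))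
              (simple₁ (Spoke.adcby Spoke.r₁)) ∷
      circuit (Spoke.ady Spoke.r₁) (walk-++ (reverse α₄) arc₄⁻ (walk-++ (reverse τ) leg₂⁻ spoke₁))
              (simple₁ (Spoke.ady Spoke.r₁)) ∷
      circuit (Spoke.abcdy Spoke.r₁)
              (walk-++ α₁ arc₁ (walk-++ α₂ arc₂ (walk-++ α₃ arc₃ (walk-++ (reverse τ) leg₂⁻ spoke₁))))
              (simple₁ (Spoke.abcdy Spoke.r₁)) ∷
      circuit (Spoke.acby Spoke.r₁) (walk-++ ρ chord (walk-++ (reverse α₂) arc₂⁻ (walk-++ σ leg₁ spoke₁)))
              (simple₁ (Spoke.acby Spoke.r₁)) ∷
      circuit (Spoke.acdy Spoke.r₁) (walk-++ ρ chord (walk-++ α₃ arc₃ (walk-++ (reverse τ) leg₂⁻ spoke₁)))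
              (simple₁ (Spoke.acdy Spoke.r₁)) ∷
      circuit (Spoke.aby Spoke.r₂) (walk-++ α₁ arc₁ (walk-++ σ leg₁ spoke₂))
              (simple₂ (Spoke.aby Spoke.r₂)) ∷
      circuit (Spoke.adcby Spoke.r₂)
              (walk-++ (reverse α₄) arc₄⁻ (walk-++ (reverse α₃) arc₃⁻ (walk-++ (reverse α₂) arc₂⁻ (walk-++ σ leg₁ spoke₂))))
              (simple₂ (Spoke.adcby Spoke.r₂)) ∷
      circuit (Spoke.ady Spoke.r₂) (walk-++ (reverse α₄) arc₄⁻ (walk-++ (reverse τ) leg₂⁻ spoke₂))
              (simple₂ (Spoke.ady Spoke.r₂)) ∷
      circuit (Spoke.abcdy Spoke.r₂)
              (walk-++ α₁ arc₁ (walk-++ α₂ arc₂ (walk-++ α₃ arc₃ (walk-++ (reverse τ) leg₂⁻ spoke₂))))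
              (simple₂ (Spoke.abcdy Spoke.r₂)) ∷
      circuit (Spoke.acby Spoke.r₂) (walk-++ ρ chord (walk-++ (reverse α₂) arc₂⁻ (walk-++ σ leg₁ spoke₂)))
              (simple₂ (Spoke.acby Spoke.r₂)) ∷
      circuit (Spoke.acdy Spoke.r₂) (walk-++ ρ chord (walk-++ α₃ arc₃ (walk-++ (reverse τ) leg₂⁻ spoke₂)))
              (simple₂ (Spoke.acdy Spoke.r₂)) ∷ []

  record Chord (L : List (Fin n)) (P : Path n) (s t : Fin n) : Set where
    constructor chord
    field
      inner        : List (Fin n)
      walk         : Walk s inner t
      inner-unique : Unique inner
      inner⊆P      : ∀ {w} → w ∈ inner → w ∈ pverts P
      inner∉L      : ∀ {w} → w ∈ inner → w ∉ L
      off-L⇒inner  : ∀ {w} → w ∈ pverts P → w ∉ L → w ∈ inner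
      length-inner : suc (length inner) ≡ plength P

  chord-reverse : ∀ {L P s t} → Chord L P s t → Chord L P t s
  chord-reverse (chord m w u ⊆P ∉L off len) =
    chord (reverse m) (walk-reverse m w) (unique-reverse u) (⊆P ∘ reverse⁻) (∉L ∘ reverse⁻)
          (λ w∈P w∉L → reverse⁺ (off w∈P w∉L)) (trans (cong suc (length-reverse m)) len)

  bridge⇒chord : ∀ {C P} → IsBridge G C P → (∀ {a b} → PEdge P a b → H a b) → Chord (cverts C) P (start P) (pend P)
  bridge⇒chord {C} {P} (isP , 1≤ , _ , s∈C , t∈C , ends) P⊆H
    with linked⇒walk (rest P) (path⇒linked isP P⊆H) (1≤length⇒≢[] 1≤)
  ... | m , rest≡ , w = chord m w (proj₁ interior) ⊆P ∉C off-C (sym (trans (cong length rest≡) (length-∷ʳ m _)))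
    where
    interior = unique-arc m (subst (λ r → Unique (start P ∷ r)) rest≡ (proj₂ isP))
    ⊆P : ∀ {w} → w ∈ m → w ∈ pverts P
    ⊆P w∈ = there (subst (_ ∈_) (sym rest≡) (∈-++⁺ˡ w∈))
    ∉C : ∀ {w} → w ∈ m → w ∉ cverts C
    ∉C w∈ w∈C with ends _ (⊆P w∈) w∈C
    ... | inj₁ refl = proj₁ (proj₂ interior) w∈
    ... | inj₂ refl = proj₂ (proj₂ interior) w∈
    off-C : ∀ {w} → w ∈ pverts P → w ∉ cverts C → w ∈ m
    off-C (here refl) w∉C = ⊥-elim (w∉C s∈C)
    off-C (there w∈)  w∉C with ∈-++⁻ m (subst (_ ∈_) rest≡ w∈)
    ... | inj₁ w∈m         = w∈m
    ... | inj₂ (here refl) = ⊥-elim (w∉C t∈C)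

  record Route (R : Adjustable n) (a b : Fin n) : Set where
    constructor route
    field
      inner   : List (Fin n)
      walk    : Walk a inner b
      unique  : Unique (a ∷ inner ∷ʳ b)
      inner⊆R : ∀ {w} → w ∈ inner → AVert R w

  module _ {R : Adjustable n} (isQ₁ : IsPath G (Q₁ R)) (isQ₂ : IsPath G (Q₂ R))
           (Q₁∩D : ∀ v → v ∈ pverts (Q₁ R) → v ∈ cverts (D R) → v ≡ pend (Q₁ R))
           (Q₂∩D : ∀ v → v ∈ pverts (Q₂ R) → v ∈ cverts (D R) → v ≡ start (Q₂ R))
           (Q₁∩Q₂ : VertexDisjoint (pverts (Q₁ R)) (pverts (Q₂ R)))
           (R⊆H : ∀ {u v} → AEdge R u v → H u v) where

    through : List (Fin n) → List (Fin n)
    through B = rest (Q₁ R) ++ B ++ start (Q₂ R) ∷ rest (Q₂ R)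

    through-linked : ∀ {B} → Walk (pend (Q₁ R)) B (start (Q₂ R)) → Linked E (start (Q₁ R) ∷ through B)
    through-linked {B} walk-B = linked-glue (rest (Q₁ R)) (path⇒linked isQ₁ (R⊆H ∘ inj₂ ∘ inj₁))
                                            (walk-glue B walk-B (path⇒linked isQ₂ (R⊆H ∘ inj₂ ∘ inj₂)))

    through-unique : ∀ {B} → Unique B → pend (Q₁ R) ∉ B → start (Q₂ R) ∉ B → B ⊆ cverts (D R) →
                     Unique (start (Q₁ R) ∷ through B)
    through-unique {B} B-unique e₁∉B e₂∉B B⊆D =
      Unique.++⁺ (proj₂ isQ₁) (Unique.++⁺ B-unique (proj₂ isQ₂) B∩Q₂) Q₁∩BQ₂
      where
      B∩Q₂ : Disjoint B (pverts (Q₂ R))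
      B∩Q₂ (w∈B , w∈Q₂) = e₂∉B (subst (_∈ B) (Q₂∩D _ w∈Q₂ (B⊆D w∈B)) w∈B)
      Q₁∩BQ₂ : Disjoint (pverts (Q₁ R)) (B ++ pverts (Q₂ R))
      Q₁∩BQ₂ (w∈Q₁ , w∈BQ₂) with ∈-++⁻ B w∈BQ₂
      ... | inj₁ w∈B  = e₁∉B (subst (_∈ B) (Q₁∩D _ w∈Q₁ (B⊆D w∈B)) w∈B)
      ... | inj₂ w∈Q₂ = Q₁∩Q₂ _ w∈Q₁ w∈Q₂

    through⊆R : ∀ {B} → B ⊆ cverts (D R) → ∀ {w} → w ∈ through B → AVert R w
    through⊆R {B} B⊆D w∈ with ∈-++⁻ (pverts (Q₁ R)) (there {x = start (Q₁ R)} w∈)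
    ... | inj₁ w∈Q₁  = inj₂ (inj₁ w∈Q₁)
    ... | inj₂ w∈BQ₂ with ∈-++⁻ B w∈BQ₂
    ...   | inj₁ w∈B  = inj₁ (B⊆D w∈B)
    ...   | inj₂ w∈Q₂ = inj₂ (inj₂ w∈Q₂)

    route-via : ∀ B → Walk (pend (Q₁ R)) B (start (Q₂ R)) → Unique B → pend (Q₁ R) ∉ B → start (Q₂ R) ∉ B →
      B ⊆ cverts (D R) → Σ (Route R (start (Q₁ R)) (pend (Q₂ R))) λ r →
        suc (length (Route.inner r)) ≡ length (rest (Q₁ R)) + (length B + suc (length (rest (Q₂ R))))
    route-via B walk-B B-unique e₁∉B e₂∉B B⊆D
      with linked⇒walk (through B) (through-linked walk-B) (++-≢[] (rest (Q₁ R)) (++-≢[] B λ ()))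
    ... | m , through≡ , walk-m =
      route m (subst (Walk _ m) last≡ walk-m)
              (subst (λ v → Unique (_ ∷ m ∷ʳ v)) last≡
                     (subst (λ r → Unique (_ ∷ r)) through≡ (through-unique B-unique e₁∉B e₂∉B B⊆D)))
              (through⊆R B⊆D ∘ subst (_ ∈_) (sym through≡) ∘ ∈-++⁺ˡ) ,
      trans (sym (trans (cong length through≡) (length-∷ʳ m _)))
            (trans (length-++ (rest (Q₁ R))) (cong (length (rest (Q₁ R)) +_) (length-++ B)))
      where
      last≡ : lastOf (start (Q₁ R)) (through B) ≡ pend (Q₂ R)
      last≡ = trans (lastOf-++ _ (rest (Q₁ R)) _) (lastOf-++ _ B _)

  adjustable⇒routes : ∀ {R a b} → IsAdjustable G a b R → (∀ {u v} → AEdge R u v → H u v) →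
    Σ (Route R a b) λ r₁ → Σ (Route R a b) λ r₂ → ¬ 2 ∣ length (Route.inner r₁) + length (Route.inner r₂)
  adjustable⇒routes {R} (hD , D-odd , isQ₁ , refl , e₁∈D , Q₁∩D , isQ₂ , refl , e₂∈D , Q₂∩D , Q₁∩Q₂) R⊆H
    with split-between (cycle⇒walk hD (R⊆H ∘ inj₁)) e₁∈D e₂∈D e₁≢e₂
    where
    e₁≢e₂ : pend (Q₁ R) ≢ start (Q₂ R)
    e₁≢e₂ eq = Q₁∩Q₂ _ (lastOf-∈ (start (Q₁ R)) (rest (Q₁ R))) (subst (_∈ pverts (Q₂ R)) (sym eq) (here refl))
  ... | σ@(split π₁ π₂ walk₁ walk₂ rotation) =
    proj₁ r₁ , proj₁ r₂ ,
    parity-of-routes (length (rest (Q₁ R))) (length (rest (Q₂ R))) (proj₂ r₁) length₂ (D-odd ∘ subst (2 ∣_) length-D)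
    where
    D-unique = proj₁ (proj₂ (proj₂ hD))
    arc₁ = unique-arc π₁ (unique-resp-↭ (↭-sym rotation) D-unique)
    arc₂ = unique-arc π₂ (unique-resp-↭ (↭-sym (Split.rotation (split-swap σ))) D-unique)
    via = route-via isQ₁ isQ₂ Q₁∩D Q₂∩D Q₁∩Q₂ R⊆H
    r₁ = via π₁ walk₁ (proj₁ arc₁) (proj₁ (proj₂ arc₁)) (proj₂ (proj₂ arc₁))
             (λ w∈ → ∈-resp-↭ rotation (there (∈-++⁺ˡ w∈)))
    r₂ = via (reverse π₂) (walk-reverse π₂ walk₂) (unique-reverse (proj₁ arc₂))
             (proj₂ (proj₂ arc₂) ∘ reverse⁻) (proj₁ (proj₂ arc₂) ∘ reverse⁻)
             (λ w∈ → ∈-resp-↭ rotation (there (∈-++⁺ʳ π₁ (there (reverse⁻ w∈)))))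
    length₂ : suc (length (Route.inner (proj₁ r₂))) ≡
              length (rest (Q₁ R)) + (length π₂ + suc (length (rest (Q₂ R))))
    length₂ = trans (proj₂ r₂) (cong (λ l → length (rest (Q₁ R)) + (l + suc (length (rest (Q₂ R)))))
                                     (length-reverse π₂))
    length-D : suc (length π₁ + suc (length π₂)) ≡ clength (D R)
    length-D = trans (sym (cong suc (length-++ π₁))) (↭-length rotation)

module Crossing {n} (G : Graph n) (C : Cycle n) (P₁ P₂ : Path n) (y x : Fin n) (R : Adjustable n) where

  Allowed : Fin n → Fin n → Set
  Allowed u v = CEdge C u v ⊎ PEdge P₁ u v ⊎ PEdge P₂ u v ⊎ AEdge R u v

  Allowed-sym : Symmetric Allowed
  Allowed-sym = Sum.map Sum.swap (Sum.map Sum.swap (Sum.map Sum.swap (Sum.map Sum.swap (Sum.map Sum.swap Sum.swap))))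

  open InGraph G Allowed Allowed-sym

  L : List (Fin n)
  L = cverts C

  record Configuration (s t c d : Fin n) : Set where
    constructor configuration
    field
      θ  : Theta L s t c d
      χ₁ : Chord L P₁ s t
      χ₂ : Chord L P₂ c d
    open Theta θ public
    open Split arcs public

  configuration-swap : ∀ {s t c d} → Configuration s t c d → Configuration t s d c
  configuration-swap (configuration θ χ₁ χ₂) = configuration (theta-swap θ) (chord-reverse χ₁) (chord-reverse χ₂)

  module Assumptions (hC : IsCycle G C) (hB₁ : IsBridge G C P₁) (hB₂ : IsBridge G C P₂) (hX : Crossed C P₁ P₂)
           (2∣P₁ : 2 ∣ plength P₁) (hR : IsAdjustable G y x R)
           (y∈P₂ : y ∈ pverts P₂) (y∉C : y ∉ L) (x∈C : x ∈ L)
           (hRv : ∀ v → AVert R v → ¬ (v ≡ x) → ¬ (v ≡ y) → v ∉ pverts P₂ × v ∉ L)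
           (hP₁R : ∀ v → v ∈ pverts P₁ → AVert R v → (v ≡ start P₁ ⊎ v ≡ pend P₁) × (v ≡ y ⊎ v ≡ x)) where

    cyclicOrder⇒theta : ∀ {a b c d} → InCyclicOrder C a b c d → Theta L a c b d
    cyclicOrder⇒theta (i , j , k , l , i<j , j<k , k<l , order) with lookup-split₄ L i<j j<k k<l
    ... | A₀ , A₁ , A₂ , A₃ , A₄ , L≡ with four-points⇒thetas A₀ A₁ A₂ A₃ A₄ L≡ (cycle⇒walk hC inj₁) | order
    ... | θ₁₃ , _   | inj₁ (refl , refl , refl , refl)               = θ₁₃
    ... | _   , θ₂₄ | inj₂ (inj₁ (refl , refl , refl , refl))        = theta-swap θ₂₄
    ... | θ₁₃ , _   | inj₂ (inj₂ (inj₁ (refl , refl , refl , refl))) = theta-swap θ₁₃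
    ... | _   , θ₂₄ | inj₂ (inj₂ (inj₂ (refl , refl , refl , refl))) = θ₂₄

    chord₁ : Chord L P₁ (start P₁) (pend P₁)
    chord₁ = bridge⇒chord hB₁ (inj₂ ∘ inj₁)

    chord₂ : Chord L P₂ (start P₂) (pend P₂)
    chord₂ = bridge⇒chord hB₂ (inj₂ ∘ inj₂ ∘ inj₁)

    crossing⇒configuration : ∃₂ λ s t → ∃₂ λ c d → Configuration s t c d
    crossing⇒configuration with proj₂ hX
    ... | inj₁ order = _ , _ , _ , _ , configuration (cyclicOrder⇒theta order) chord₁ chord₂
    ... | inj₂ order = _ , _ , _ , _ , configuration (cyclicOrder⇒theta order) chord₁ (chord-reverse chord₂)

    routes : Σ (Route R y x) λ r₁ → Σ (Route R y x) λ r₂ → ¬ 2 ∣ length (Route.inner r₁) + length (Route.inner r₂)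
    routes = adjustable⇒routes hR (inj₂ ∘ inj₂ ∘ inj₂)

    r₁ r₂ : Route R y x
    r₁ = proj₁ routes
    r₂ = proj₁ (proj₂ routes)

    route-avoids : (r : Route R y x) → ∀ {w} → w ∈ Route.inner r → w ∉ L × w ∉ pverts P₂ × w ∉ pverts P₁
    route-avoids (route m _ unique m⊆R) w∈m =
      proj₂ off , proj₁ off , λ w∈P₁ → [ w≢y , w≢x ]′ (proj₂ (hP₁R _ w∈P₁ (m⊆R w∈m)))
      where
      ends = unique-arc m unique
      w≢y : _ ≢ y
      w≢y refl = proj₁ (proj₂ ends) w∈m
      w≢x : _ ≢ x
      w≢x refl = proj₂ (proj₂ ends) w∈m
      off = hRv _ (m⊆R w∈m) w≢x w≢y

    pieces-unique : ∀ {rim} → rim ↭ L → ∀ {s t c d} (χ₁ : Chord L P₁ s t) (χ₂ : Chord L P₂ c d) (r : Route R y x) →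
                    Unique (rim ++ Chord.inner χ₁ ++ Chord.inner χ₂ ++ Route.inner r)
    pieces-unique rim↭L χ₁ χ₂ r =
      Unique.++⁺ (unique-resp-↭ (↭-sym rim↭L) (proj₁ (proj₂ (proj₂ hC))))
        (Unique.++⁺ (Chord.inner-unique χ₁)
          (Unique.++⁺ (Chord.inner-unique χ₂) (proj₁ (unique-arc (Route.inner r) (Route.unique r))) σ∩r)
          ρ∩σr)
        rim∩ρσr
      where
      σ∩r : Disjoint (Chord.inner χ₂) (Route.inner r)
      σ∩r (w∈σ , w∈r) = proj₁ (proj₂ (route-avoids r w∈r)) (Chord.inner⊆P χ₂ w∈σ)
      ρ∩σr : Disjoint (Chord.inner χ₁) (Chord.inner χ₂ ++ Route.inner r)
      ρ∩σr (w∈ρ , w∈σr) with ∈-++⁻ (Chord.inner χ₂) w∈σr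
      ... | inj₁ w∈σ = proj₁ hX _ (Chord.inner⊆P χ₁ w∈ρ) (Chord.inner⊆P χ₂ w∈σ)
      ... | inj₂ w∈r = proj₂ (proj₂ (route-avoids r w∈r)) (Chord.inner⊆P χ₁ w∈ρ)
      rim∩ρσr : Disjoint _ (Chord.inner χ₁ ++ Chord.inner χ₂ ++ Route.inner r)
      rim∩ρσr (w∈rim , w∈ρσr) with ∈-resp-↭ rim↭L w∈rim | ∈-++⁻ (Chord.inner χ₁) w∈ρσr
      ... | w∈L | inj₁ w∈ρ  = Chord.inner∉L χ₁ w∈ρ w∈L
      ... | w∈L | inj₂ w∈σr with ∈-++⁻ (Chord.inner χ₂) w∈σr
      ...   | inj₁ w∈σ = Chord.inner∉L χ₂ w∈σ w∈L
      ...   | inj₂ w∈r = proj₁ (route-avoids r w∈r) w∈L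

    chord-even : ∀ {s t} (χ : Chord L P₁ s t) → 2 ∣ suc (length (Chord.inner χ))
    chord-even χ = subst (2 ∣_) (sym (Chord.length-inner χ)) 2∣P₁

    x∈π₁⇒cycle : ∀ {s t c d} (κ : Configuration s t c d) → x ∈ Configuration.π₁ κ →
                 [ length L ]₄ ≡ 2₄ → Cycle0mod4 G Allowed
    x∈π₁⇒cycle {s} {t} {d = d}
               (configuration (theta (split π₁ π₂ w₁ w₂ rot) _ d∈π₂) χ₁ χ₂@(chord _ w-σ _ _ _ off _)) x∈π₁ C≡2
      with ∈-∃++ x∈π₁ | ∈-∃++ d∈π₂ | ∈-∃++ (off y∈P₂ y∉C)
    ... | α₁ , α₂ , refl | α₃ , α₄ , refl | σ₁ , σ₂ , refl =
      K₄-cycle (record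
        { a = s ; b = x ; c = t ; d = d
        ; α₁ = α₁ ; α₂ = α₂ ; α₃ = α₃ ; α₄ = α₄ ; ρ = Chord.inner χ₁ ; z₁ = spoke r₁ ; z₂ = spoke r₂
        ; arc₁ = proj₁ (walk-split α₁ w₁) ; arc₂ = proj₂ (walk-split α₁ w₁)
        ; arc₃ = proj₁ (walk-split α₃ w₂) ; arc₄ = proj₂ (walk-split α₃ w₂)
        ; chord = Chord.walk χ₁
        ; spoke₁ = spoke-walk r₁ ; spoke₂ = spoke-walk r₂
        ; unique₁ = spoke-unique r₁ ; unique₂ = spoke-unique r₂
        })
        (trans (cong [_]₄ (↭-length rot)) C≡2) (chord-even χ₁) spokes-odd
      where
      spoke : Route R y x → List (Fin n)
      spoke r = reverse σ₂ ++ y ∷ Route.inner r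
      spoke-walk : (r : Route R y x) → Walk d (spoke r) x
      spoke-walk r = walk-++ (reverse σ₂) (walk-reverse σ₂ (proj₂ (walk-split σ₁ w-σ))) (Route.walk r)
      rim = s ∷ (α₁ ++ x ∷ α₂) ++ t ∷ (α₃ ++ d ∷ α₄)
      spoke-unique : (r : Route R y x) → Unique (rim ++ Chord.inner χ₁ ++ spoke r)
      spoke-unique r = unique-reverse-leg rim (Chord.inner χ₁) σ₁ σ₂ (Route.inner r) (pieces-unique rot χ₁ χ₂ r)
      spokes-odd : ¬ 2 ∣ length (spoke r₁) + length (spoke r₂)
      spokes-odd = subst (λ l → ¬ 2 ∣ l) (sym (cong₂ _+_ (length-++ (reverse σ₂)) (length-++ (reverse σ₂))))
                         (odd-shift (length (reverse σ₂)) (proj₂ (proj₂ routes)))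

    x≡s⇒cycle : ∀ {s t c d} (κ : Configuration s t c d) → x ≡ s → [ length L ]₄ ≡ 2₄ → Cycle0mod4 G Allowed
    x≡s⇒cycle {t = t} {c} {d}
              (configuration (theta (split π₁ π₂ w₁ w₂ rot) c∈π₁ d∈π₂) χ₁ χ₂@(chord _ w-σ _ _ _ off _)) refl C≡2
      with ∈-∃++ c∈π₁ | ∈-∃++ d∈π₂ | ∈-∃++ (off y∈P₂ y∉C)
    ... | α₁ , α₂ , refl | α₃ , α₄ , refl | σ₁ , σ₂ , refl =
      spoke-cycle (record
        { a = x ; b = c ; c = t ; d = d ; y = y
        ; α₁ = α₁ ; α₂ = α₂ ; α₃ = α₃ ; α₄ = α₄ ; ρ = Chord.inner χ₁ ; σ = σ₁ ; τ = σ₂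
        ; r₁ = Route.inner r₁ ; r₂ = Route.inner r₂
        ; arc₁ = proj₁ (walk-split α₁ w₁) ; arc₂ = proj₂ (walk-split α₁ w₁)
        ; arc₃ = proj₁ (walk-split α₃ w₂) ; arc₄ = proj₂ (walk-split α₃ w₂)
        ; chord = Chord.walk χ₁
        ; leg₁ = proj₁ (walk-split σ₁ w-σ) ; leg₂ = proj₂ (walk-split σ₁ w-σ)
        ; spoke₁ = Route.walk r₁ ; spoke₂ = Route.walk r₂
        ; unique₁ = pieces-unique rot χ₁ χ₂ r₁ ; unique₂ = pieces-unique rot χ₁ χ₂ r₂
        })
        (trans (cong [_]₄ (↭-length rot)) C≡2) (chord-even χ₁) (proj₂ (proj₂ routes))

    configuration⇒cycle : ∀ {s t c d} → Configuration s t c d → [ length L ]₄ ≡ 2₄ → Cycle0mod4 G Allowed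
    configuration⇒cycle κ C≡2 with ∈-resp-↭ (↭-sym (Configuration.rotation κ)) x∈C
    ... | here x≡s = x≡s⇒cycle κ x≡s C≡2
    ... | there x∈ with ∈-++⁻ (Configuration.π₁ κ) x∈
    ...   | inj₁ x∈π₁         = x∈π₁⇒cycle κ x∈π₁ C≡2
    ...   | inj₂ (here x≡t)   = x≡s⇒cycle (configuration-swap κ) x≡t C≡2
    ...   | inj₂ (there x∈π₂) = x∈π₁⇒cycle (configuration-swap κ) x∈π₂ C≡2

lemma4 : ∀ {n} (G : Graph n) (C : Cycle n) (P₁ P₂ : Path n) (y x : Fin n) (R : Adjustable n)
    → IsCycle G C → 2 ∣ clength C
    → IsBridge G C P₁ → IsBridge G C P₂ → Crossed C P₁ P₂
    → 2 ∣ plength P₁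
    → IsAdjustable G y x R
    → y ∈ pverts P₂ → ¬ (y ∈ cverts C) → x ∈ cverts C
    → (∀ v → AVert R v → ¬ (v ≡ x) → ¬ (v ≡ y) → ¬ (v ∈ pverts P₂) × ¬ (v ∈ cverts C))
    → (∀ v → v ∈ pverts P₁ → AVert R v → (v ≡ start P₁ ⊎ v ≡ pend P₁) × (v ≡ y ⊎ v ≡ x))
    → Σ (Cycle n) λ K → IsCycle G K
        × (∀ u v → CEdge K u v → CEdge C u v ⊎ PEdge P₁ u v ⊎ PEdge P₂ u v ⊎ AEdge R u v)
        × 4 ∣ clength K
lemma4 G C P₁ P₂ y x R hC 2∣C hB₁ hB₂ hX 2∣P₁ hR y∈P₂ y∉C x∈C hRv hP₁R with 2∣⇒≡0∨≡2 2∣C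
... | inj₁ C≡0 = C , hC , (λ _ _ → inj₁) , []₄≡0⇒4∣ _ C≡0
... | inj₂ C≡2 = let _ , _ , _ , _ , κ = crossing⇒configuration in configuration⇒cycle κ C≡2
  where open Crossing G C P₁ P₂ y x R
        open Assumptions hC hB₁ hB₂ hX 2∣P₁ hR y∈P₂ y∉C x∈C hRv hP₁R
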